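{- Let $p>3$ be a prime and $m\ge1$ an integer. If $\iota(p^m)<\rho(p^m)$, then $\iota(p^{m+1})<p^{m+1}/2$.
   Context: The Salajan sequence is $u_1,u_2,\ldots$ with $u_j=(3^j-5(-1)^j)/4$ for $j\ge1$. For $p>3$ prime, this sequence is purely periodic modulo $p^m$, and $\rho(p^m)$ denotes its period, i.e. the smallest $k\ge1$ with $u_n\equiv u_{n+k}\pmod{p^m}$ for all $n\ge1$. For a positive integer $N$, the incongruence index $\iota(N)$ is the largest integer $k$ such that $u_1,\ldots,u_k$ are pairwise incongruent modulo $N$. -}

module Defs where

open import Data.Nat as ℕ using (ℕ; suc; _≤_; _<_)
open import Data.Integer as ℤ using (ℤ; +_; -[1+_]; _-_; _*_)
open import Data.Integer.DivMod using (_/_)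
open import Data.Integer.Divisibility using (_∣_)
open import Relation.Nullary using (¬_)

neg1^ : ℕ → ℤ
neg1^ 0 = + 1
neg1^ (suc j) = ℤ.- neg1^ j

-- Salajan sequence: u_j = (3^j - 5 (-1)^j) / 4  (exact division; used for j ≥ 1)
u : ℕ → ℤ
u j = ((+ (3 ℕ.^ j)) - (+ 5) * neg1^ j) / (+ 4)

_≡_[mod_] : ℤ → ℤ → ℕ → Set
a ≡ b [mod N ] = (+ N) ∣ (a - b)

IsPeriod : ℕ → ℕ → Set
IsPeriod N k = ∀ n → 1 ≤ n → u n ≡ u (n ℕ.+ k) [mod N ]

IsRho : ℕ → ℕ → Set
IsRho N r = 1 ≤ r × IsPeriod N r × (∀ k → 1 ≤ k → IsPeriod N k → r ≤ k)
  where open import Data.Product using (_×_)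

PairwiseIncong : ℕ → ℕ → Set
PairwiseIncong N k = ∀ a b → 1 ≤ a → a < b → b ≤ k → ¬ (u a ≡ u b [mod N ])

IsIota : ℕ → ℕ → Set
IsIota N i = PairwiseIncong N i × (∀ k → PairwiseIncong N k → k ≤ i)
  where open import Data.Product using (_×_)

-- Write q = p^m, P = φ(q) = p^(m-1)(p-1) = 2 p^(m-1) h with p = 2h + 1, and 4u_j = 3^j - 5(-1)^j.
-- By Euler 3^P = 1 + Tq, and P is even, so P is a period of u modulo q; hence ρ(q) ≤ P, and
-- ι(q) < ρ(q) yields a < b = ι(q) + 1 ≤ P with u_a ≡ u_b (mod q), say 4u_a - 4u_b = sq.
-- If p ∣ T then P is a period modulo pq as well, so ι(pq) ≤ P. Otherwise the numbers s + T3^a k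
-- and the numbers T3^b j (0 ≤ k, j ≤ h) are distinct modulo p within each family, and 2h + 2 > p,
-- so some s + T3^a k ≡ T3^b j (mod p). As 4u_(kP+a) ≡ 4u_a + T3^a k q (mod pq), this gives
-- u_(kP+a) ≡ u_(jP+b) (mod pq) with both indices at most P(h + 1). Either way
-- 2ι(pq) < 2P(h + 1) = p^(m-1)(p^2 - 1) < p^(m+1).
module Submission where

open import Defs

module PrimeArithmetic where

  open import Data.Nat
  open import Data.Nat.Properties
  open import Data.Nat.Divisibility
  open import Data.Nat.DivMod using (m≡m%n+[m/n]*n; m%n<n)
  open import Data.Nat.Primality
  open import Data.Nat.Combinatorics using (_C_; nCn≡1; nCk≡n!/k![n-k]!; k![n∸k]!∣n!)
  open import Data.Nat.Tactic.RingSolver using (solve-∀; solve)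
  open import Data.List.Base using (_∷_; [])
  open import Data.Fin.Base using (Fin; toℕ; fromℕ; inject₁) renaming (zero to fzero; suc to fsuc)
  open import Data.Fin.Properties using (toℕ<n; toℕ-fromℕ; toℕ-inject₁)
  open import Data.Product using (∃; _,_)
  open import Data.Sum using ([_,_]′; inj₁; inj₂)
  open import Data.Vec.Functional using (Vector)
  open import Data.Empty using (⊥-elim)
  open import Function using (_∘_)
  open import Relation.Binary.PropositionalEquality
  open import Algebra.Definitions.RawSemiring +-*-rawSemiring using (sum) renaming (_×_ to _×ₛ_; _^_ to _^ₛ_)
  open import Algebra.Properties.Semiring.Sum +-*-semiring using (sum-init-last)
  import Algebra.Properties.Semiring.Binomial as Binomial

  private variable k m n p : ℕ

  ∣∧<⇒≡0 : ∀ {d} → d ∣ n → n < d → n ≡ 0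
  ∣∧<⇒≡0 {n = zero}  _   _   = refl
  ∣∧<⇒≡0 {n = suc _} d∣n n<d = ⊥-elim (>⇒∤ n<d d∣n)

  prime⇒1<p : Prime p → 1 < p
  prime⇒1<p p-prime = nonTrivial⇒n>1 _ {{prime⇒nonTrivial p-prime}}

  prime∤-* : Prime p → p ∤ m → p ∤ n → p ∤ m * n
  prime∤-* p-prime p∤m p∤n p∣mn = [ p∤m , p∤n ]′ (euclidsLemma _ _ p-prime p∣mn)

  prime∤-^ : Prime p → p ∤ m → ∀ n → p ∤ m ^ n
  prime∤-^ p-prime _   zero    = >⇒∤ (prime⇒1<p p-prime)
  prime∤-^ p-prime p∤m (suc n) = prime∤-* p-prime p∤m (prime∤-^ p-prime p∤m n)

  prime∤-! : Prime p → n < p → p ∤ n !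
  prime∤-! {n = zero}  p-prime _   = >⇒∤ (prime⇒1<p p-prime)
  prime∤-! {n = suc n} p-prime n<p = prime∤-* p-prime (>⇒∤ n<p) (prime∤-! p-prime (<⇒≤ n<p))

  n!≡nCk*k![n∸k]! : k ≤ n → n ! ≡ (n C k) * (k ! * (n ∸ k) !)
  n!≡nCk*k![n∸k]! {k} {n} k≤n = begin
    n !                 ≡⟨ m∣n⇒n≡quotient*m d∣n! ⟩
    quotient d∣n! * d   ≡⟨ cong (_* d) (n/m≡quotient d∣n!) ⟨
    n ! / d * d         ≡⟨ cong (_* d) (nCk≡n!/k![n-k]! k≤n) ⟨
    (n C k) * d         ∎
    where
    open ≡-Reasoning
    d = k ! * (n ∸ k) !
    instance _ = k !* (n ∸ k) !≢0
    d∣n! = k![n∸k]!∣n! k≤n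

  prime∣pCk : Prime p → 0 < k → k < p → p ∣ p C k
  prime∣pCk {p@(suc p-1)} {k} p-prime 0<k k<p
    with euclidsLemma _ _ p-prime (subst (p ∣_) (n!≡nCk*k![n∸k]! (<⇒≤ k<p)) (m∣m*n (p-1 !)))
  ... | inj₁ p∣pCk = p∣pCk
  ... | inj₂ p∣d   = ⊥-elim (prime∤-* p-prime (prime∤-! p-prime k<p)
                               (prime∤-! p-prime (∸-monoʳ-< 0<k (<⇒≤ k<p))) p∣d)

  ×ₛ≡* : ∀ n x → n ×ₛ x ≡ n * x
  ×ₛ≡* zero    x = refl
  ×ₛ≡* (suc n) x = cong (x +_) (×ₛ≡* n x)

  ^ₛ≡^ : ∀ x n → x ^ₛ n ≡ x ^ n
  ^ₛ≡^ x zero    = refl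
  ^ₛ≡^ x (suc n) = cong (x *_) (^ₛ≡^ x n)

  ∣-sum : ∀ {d} (t : Vector ℕ n) → (∀ i → d ∣ t i) → d ∣ sum t
  ∣-sum {n = zero}  t d∣t = _ ∣0
  ∣-sum {n = suc n} t d∣t = ∣m∣n⇒∣m+n (d∣t fzero) (∣-sum (t ∘ fsuc) (d∣t ∘ fsuc))

  module _ (x : ℕ) where
    open Binomial +-*-semiring x 1 using (theorem; binomialTerm)

    binomialTerm≡ : ∀ n (k : Fin (suc n)) → binomialTerm n k ≡ (n C toℕ k) * x ^ toℕ k
    binomialTerm≡ n k = begin
      (n C j) ×ₛ (x ^ₛ j * 1 ^ₛ (n ∸ j)) ≡⟨ ×ₛ≡* (n C j) _ ⟩
      (n C j) * (x ^ₛ j * 1 ^ₛ (n ∸ j))  ≡⟨ cong₂ (λ a b → (n C j) * (a * b)) (^ₛ≡^ x j)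
                                              (trans (^ₛ≡^ 1 (n ∸ j)) (^-zeroˡ (n ∸ j))) ⟩
      (n C j) * (x ^ j * 1)              ≡⟨ cong ((n C j) *_) (*-identityʳ (x ^ j)) ⟩
      (n C j) * x ^ j                    ∎
      where
      open ≡-Reasoning
      j = toℕ k

    frobenius : Prime p → ∃ λ K → (x + 1) ^ p ≡ 1 + K * p + x ^ p
    frobenius {p@(suc (suc n))} p-prime = quotient p∣middle , (begin
      (x + 1) ^ p                                ≡⟨ ^ₛ≡^ (x + 1) p ⟨
      (x + 1) ^ₛ p                               ≡⟨ theorem (*-comm x 1) p ⟩
      term fzero + sum (term ∘ fsuc)             ≡⟨ cong (term fzero +_) (sum-init-last (term ∘ fsuc)) ⟩
      term fzero + (sum middle + term (fromℕ p)) ≡⟨ cong₂ (λ a b → a + (sum middle + b))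
                                                      (binomialTerm≡ p fzero) (trans (binomialTerm≡ p (fromℕ p)) last≡) ⟩
      1 + (sum middle + x ^ p)                   ≡⟨ cong (λ s → 1 + (s + x ^ p)) (m∣n⇒n≡quotient*m p∣middle) ⟩
      1 + (quotient p∣middle * p + x ^ p)        ≡⟨ +-assoc 1 (quotient p∣middle * p) (x ^ p) ⟨
      1 + quotient p∣middle * p + x ^ p          ∎)
      where
      open ≡-Reasoning
      term = binomialTerm p
      middle : Vector ℕ (suc n)
      middle i = term (fsuc (inject₁ i))
      last≡ : (p C toℕ (fromℕ p)) * x ^ toℕ (fromℕ p) ≡ x ^ p
      last≡ = begin
        (p C toℕ (fromℕ p)) * x ^ toℕ (fromℕ p) ≡⟨ cong (λ j → (p C j) * x ^ j) (toℕ-fromℕ p) ⟩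
        (p C p) * x ^ p                         ≡⟨ cong (_* x ^ p) (nCn≡1 p) ⟩
        1 * x ^ p                               ≡⟨ *-identityˡ (x ^ p) ⟩
        x ^ p                                   ∎
      p∣middle : p ∣ sum middle
      p∣middle = ∣-sum middle λ i → subst (p ∣_) (sym (binomialTerm≡ p (fsuc (inject₁ i))))
        (∣m⇒∣m*n _ (prime∣pCk p-prime (s≤s z≤n) (s≤s (subst (_< suc n) (sym (toℕ-inject₁ i)) (toℕ<n i)))))

  fermat : Prime p → ∀ x → ∃ λ L → x ^ p ≡ x + L * p
  fermat {suc _} p-prime zero    = 0 , refl
  fermat {p}     p-prime (suc x) with fermat p-prime x | frobenius x p-prime
  ... | L , xᵖ≡ | K , [x+1]ᵖ≡ = L + K , (begin
    suc x ^ p               ≡⟨ cong (_^ p) (+-comm 1 x) ⟩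
    (x + 1) ^ p             ≡⟨ [x+1]ᵖ≡ ⟩
    1 + K * p + x ^ p       ≡⟨ cong (1 + K * p +_) xᵖ≡ ⟩
    1 + K * p + (x + L * p) ≡⟨ solve (x ∷ L ∷ K ∷ p ∷ []) ⟩
    suc x + (L + K) * p     ∎)
    where open ≡-Reasoning

  infix 4 _≡1[mod_]
  _≡1[mod_] : ℕ → ℕ → Set
  a ≡1[mod n ] = ∃ λ T → a ≡ 1 + T * n

  fermat-unit : ∀ {a} → Prime p → p ∤ a → a ^ (p ∸ 1) ≡1[mod p ]
  fermat-unit {a = zero} p-prime p∤0 = ⊥-elim (p∤0 (_ ∣0))
  fermat-unit {p@(suc p-1)} {a@(suc _)} p-prime p∤a with fermat p-prime a
  ... | L , aᵖ≡ = quotient p∣w , trans (sym 1+w≡) (cong (1 +_) (m∣n⇒n≡quotient*m p∣w))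
    where
    w = a ^ p-1 ∸ 1
    1+w≡ : 1 + w ≡ a ^ p-1
    1+w≡ = m+[n∸m]≡n (m^n>0 a p-1)
    a+aw≡a+Lp : a + a * w ≡ a + L * p
    a+aw≡a+Lp = begin
      a + a * w     ≡⟨ cong (_+ a * w) (*-identityʳ a) ⟨
      a * 1 + a * w ≡⟨ *-distribˡ-+ a 1 w ⟨
      a * (1 + w)   ≡⟨ cong (a *_) 1+w≡ ⟩
      a ^ p         ≡⟨ aᵖ≡ ⟩
      a + L * p     ∎
      where open ≡-Reasoning
    p∣w : p ∣ w
    p∣w = [ (λ p∣a → ⊥-elim (p∤a p∣a)) , (λ p∣w → p∣w) ]′
            (euclidsLemma a w p-prime (divides L (+-cancelˡ-≡ a _ _ a+aw≡a+Lp)))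

  [1+y]^n≡1+n*y+O[y²] : ∀ y n → ∃ λ c → (1 + y) ^ n ≡ 1 + n * y + c * (y * y)
  [1+y]^n≡1+n*y+O[y²] y zero    = 0 , refl
  [1+y]^n≡1+n*y+O[y²] y (suc n) with [1+y]^n≡1+n*y+O[y²] y n
  ... | c , eq = c + n + c * y , (begin
    (1 + y) * (1 + y) ^ n                      ≡⟨ cong ((1 + y) *_) eq ⟩
    (1 + y) * (1 + n * y + c * (y * y))        ≡⟨ solve (y ∷ n ∷ c ∷ []) ⟩
    1 + suc n * y + (c + n + c * y) * (y * y)  ∎)
    where open ≡-Reasoning

  ^p-lift : ∀ {a} k → a ≡1[mod p ^ suc k ] → a ^ p ≡1[mod p ^ suc (suc k) ]
  ^p-lift {p} {a} k (T , a≡) with [1+y]^n≡1+n*y+O[y²] (T * p ^ suc k) p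
  ... | c , eq = T + c * T * T * Z , (begin
    a ^ p                                                     ≡⟨ cong (_^ p) a≡ ⟩
    (1 + T * (p * Z)) ^ p                                     ≡⟨ eq ⟩
    1 + p * (T * (p * Z)) + c * (T * (p * Z) * (T * (p * Z))) ≡⟨ collect p Z T c ⟩
    1 + (T + c * T * T * Z) * (p * (p * Z))                   ∎)
    where
    open ≡-Reasoning
    Z = p ^ k
    collect : ∀ p Z T c → 1 + p * (T * (p * Z)) + c * (T * (p * Z) * (T * (p * Z)))
                        ≡ 1 + (T + c * T * T * Z) * (p * (p * Z))
    collect = solve-∀

  euler : ∀ {a} → Prime p → p ∤ a → ∀ k → a ^ (p ^ k * (p ∸ 1)) ≡1[mod p ^ suc k ]
  euler {p} {a} p-prime p∤a zero with fermat-unit p-prime p∤a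
  ... | T , eq = T , (begin
    a ^ (1 * (p ∸ 1)) ≡⟨ cong (a ^_) (*-identityˡ (p ∸ 1)) ⟩
    a ^ (p ∸ 1)       ≡⟨ eq ⟩
    1 + T * p         ≡⟨ cong (λ n → 1 + T * n) (*-identityʳ p) ⟨
    1 + T * (p * 1)   ∎)
    where open ≡-Reasoning
  euler {p} {a} p-prime p∤a (suc k) =
    subst (_≡1[mod p ^ suc (suc k) ]) aᵖ≡ (^p-lift {p} k (euler p-prime p∤a k))
    where
    aᵖ≡ : (a ^ (p ^ k * (p ∸ 1))) ^ p ≡ a ^ (p ^ suc k * (p ∸ 1))
    aᵖ≡ = begin
      (a ^ (p ^ k * (p ∸ 1))) ^ p ≡⟨ ^-*-assoc a (p ^ k * (p ∸ 1)) p ⟩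
      a ^ (p ^ k * (p ∸ 1) * p)   ≡⟨ cong (a ^_) (rotate (p ^ k) (p ∸ 1) p) ⟩
      a ^ (p * p ^ k * (p ∸ 1))   ∎
      where
      open ≡-Reasoning
      rotate : ∀ m n o → m * n * o ≡ o * m * n
      rotate = solve-∀

  prime^-∣-cancelˡ : Prime p → ∀ {c} → p ∤ c → ∀ k {x} → p ^ k ∣ c * x → p ^ k ∣ x
  prime^-∣-cancelˡ p-prime p∤c zero    _ = 1∣ _
  prime^-∣-cancelˡ {p} p-prime {c} p∤c (suc k) {x} p^[1+k]∣cx
    with euclidsLemma c x p-prime (∣-trans (m∣m*n (p ^ k)) p^[1+k]∣cx)
  ... | inj₁ p∣c = ⊥-elim (p∤c p∣c)
  ... | inj₂ (divides y refl) = subst (p ^ suc k ∣_) (*-comm p y) (*-monoʳ-∣ p p^k∣y)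
    where
    instance _ = prime⇒nonZero p-prime
    p^k∣y : p ^ k ∣ y
    p^k∣y = prime^-∣-cancelˡ p-prime p∤c k (*-cancelˡ-∣ p
              (subst (p ^ suc k ∣_) (trans (sym (*-assoc c y p)) (*-comm (c * y) p)) p^[1+k]∣cx))

  odd-prime : Prime p → 2 < p → ∃ λ h → p ≡ suc (h * 2)
  odd-prime {p} p-prime 2<p with p % 2 | m≡m%n+[m/n]*n p 2 | m%n<n p 2
  ... | 0           | p≡ | _ = ⊥-elim ([ (λ ()) , (λ 2≡p → <-irrefl 2≡p 2<p) ]′
                                   (prime⇒irreducible p-prime (divides (p / 2) p≡)))
  ... | 1           | p≡ | _ = p / 2 , p≡
  ... | suc (suc _) | _  | s≤s (s≤s ())

module Numerator where

  open import Data.Nat as ℕ using (ℕ; zero; suc)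
  import Data.Nat.Properties as ℕ
  import Data.Nat.Divisibility as ℕ
  import Data.Nat.Tactic.RingSolver as ℕ-Solver
  open import Data.Nat.Primality using (Prime)
  open import Data.Integer.Base using (ℤ; +_; _+_; _-_; _*_; -_; ∣_∣; 0ℤ; -1ℤ; NonZero; _/_; _%_)
  open import Data.Integer.Properties using (pos-*; pos-+; abs-*; neg-involutive; +-identityˡ; +-inverseʳ)
  open import Data.Integer.DivMod using (a≡a%n+[a/n]*n; n%d<d)
  open import Data.Integer.Divisibility.Signed
  open import Data.Integer.Tactic.RingSolver using (solve-∀)
  open import Data.Product using (∃; _,_)
  open import Relation.Binary.PropositionalEquality
  open PrimeArithmetic

  [a/d]*d≡a : ∀ {a d} .{{_ : NonZero d}} → d ∣ a → (a / d) * d ≡ a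
  [a/d]*d≡a {a} {d} d∣a = begin
    (a / d) * d               ≡⟨ +-identityˡ _ ⟨
    + 0 + (a / d) * d         ≡⟨ cong (λ r → + r + (a / d) * d) a%d≡0 ⟨
    + (a % d) + (a / d) * d   ≡⟨ a≡a%n+[a/n]*n a d ⟨
    a                         ∎
    where
    open ≡-Reasoning
    d∣a%d : d ∣ + (a % d)
    d∣a%d = ∣m+n∣n⇒∣m (subst (d ∣_) (a≡a%n+[a/n]*n a d) d∣a) (∣n⇒∣m*n (a / d) ∣-refl)
    a%d≡0 : a % d ≡ 0
    a%d≡0 = ∣∧<⇒≡0 (∣⇒∣ᵤ d∣a%d) (n%d<d a d)

  4u : ℕ → ℤ
  4u j = + (3 ℕ.^ j) - + 5 * neg1^ j

  4u-suc : ∀ j → 4u (suc j) ≡ + 3 * 4u j + + 20 * neg1^ j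
  4u-suc j = begin
    + (3 ℕ.* 3 ℕ.^ j) - + 5 * - neg1^ j ≡⟨ cong (λ t → t - + 5 * - neg1^ j) (pos-* 3 (3 ℕ.^ j)) ⟩
    + 3 * + (3 ℕ.^ j) - + 5 * - neg1^ j ≡⟨ expand (+ (3 ℕ.^ j)) (neg1^ j) ⟩
    + 3 * 4u j + + 20 * neg1^ j         ∎
    where
    open ≡-Reasoning
    expand : ∀ t s → + 3 * t - + 5 * - s ≡ + 3 * (t - + 5 * s) + + 20 * s
    expand = solve-∀

  4∣4u : ∀ j → + 4 ∣ 4u j
  4∣4u zero    = divides -1ℤ refl
  4∣4u (suc j) = subst (+ 4 ∣_) (sym (4u-suc j))
    (∣m∣n⇒∣m+n (∣n⇒∣m*n (+ 3) (4∣4u j)) (∣m⇒∣m*n (neg1^ j) (divides (+ 5) refl)))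

  u*4≡4u : ∀ j → u j * + 4 ≡ 4u j
  u*4≡4u j = [a/d]*d≡a (4∣4u j)

  4u-difference : ∀ a b → 4u a - 4u b ≡ + 4 * (u a - u b)
  4u-difference a b = begin
    4u a - 4u b              ≡⟨ cong₂ _-_ (u*4≡4u a) (u*4≡4u b) ⟨
    u a * + 4 - u b * + 4    ≡⟨ factor (u a) (u b) ⟩
    + 4 * (u a - u b)        ∎
    where
    open ≡-Reasoning
    factor : ∀ x y → x * + 4 - y * + 4 ≡ + 4 * (x - y)
    factor = solve-∀

  ≡[mod]⇒∣4u : ∀ {N a b} → u a ≡ u b [mod N ] → + N ∣ 4u a - 4u b
  ≡[mod]⇒∣4u {a = a} {b} ua≡ub = subst (_ ∣_) (sym (4u-difference a b)) (∣n⇒∣m*n (+ 4) (∣ᵤ⇒∣ ua≡ub))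

  ∣4u⇒≡[mod] : ∀ {p} → Prime p → p ℕ.∤ 4 → ∀ k a b → + (p ℕ.^ k) ∣ 4u a - 4u b → u a ≡ u b [mod p ℕ.^ k ]
  ∣4u⇒≡[mod] p-prime p∤4 k a b p^k∣ = prime^-∣-cancelˡ p-prime p∤4 k
    (subst (_ ℕ.∣_) (abs-* (+ 4) (u a - u b)) (subst (λ z → _ ℕ.∣ ∣ z ∣) (4u-difference a b) (∣⇒∣ᵤ p^k∣)))

  neg1^-even+ : ∀ c n → neg1^ (c ℕ.* 2 ℕ.+ n) ≡ neg1^ n
  neg1^-even+ zero    n = refl
  neg1^-even+ (suc c) n = trans (neg-involutive _) (neg1^-even+ c n)

  4u-even-shift : ∀ c n {Z} → 3 ℕ.^ (c ℕ.* 2) ≡ 1 ℕ.+ Z → 4u (c ℕ.* 2 ℕ.+ n) ≡ 4u n + + (3 ℕ.^ n ℕ.* Z)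
  4u-even-shift c n {Z} 3ᴷ≡ = begin
    + (3 ℕ.^ (K ℕ.+ n)) - + 5 * neg1^ (K ℕ.+ n)     ≡⟨ cong₂ (λ t s → + t - + 5 * s) 3ᴷ⁺ⁿ≡ (neg1^-even+ c n) ⟩
    + (3ⁿ ℕ.+ 3ⁿ ℕ.* Z) - + 5 * neg1^ n             ≡⟨ cong (_- + 5 * neg1^ n) (pos-+ 3ⁿ (3ⁿ ℕ.* Z)) ⟩
    + 3ⁿ + + (3ⁿ ℕ.* Z) - + 5 * neg1^ n             ≡⟨ swap (+ 3ⁿ) (+ (3ⁿ ℕ.* Z)) (+ 5 * neg1^ n) ⟩
    4u n + + (3ⁿ ℕ.* Z)                             ∎
    where
    open ≡-Reasoning
    K = c ℕ.* 2
    3ⁿ = 3 ℕ.^ n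
    3ᴷ⁺ⁿ≡ : 3 ℕ.^ (K ℕ.+ n) ≡ 3ⁿ ℕ.+ 3ⁿ ℕ.* Z
    3ᴷ⁺ⁿ≡ = begin
      3 ℕ.^ (K ℕ.+ n)      ≡⟨ ℕ.^-distribˡ-+-* 3 K n ⟩
      3 ℕ.^ K ℕ.* 3ⁿ       ≡⟨ cong (ℕ._* 3ⁿ) 3ᴷ≡ ⟩
      (1 ℕ.+ Z) ℕ.* 3ⁿ     ≡⟨ spread Z 3ⁿ ⟩
      3ⁿ ℕ.+ 3ⁿ ℕ.* Z      ∎
      where
      spread : ∀ Z t → (1 ℕ.+ Z) ℕ.* t ≡ t ℕ.+ t ℕ.* Z
      spread = ℕ-Solver.solve-∀
    swap : ∀ t e s → t + e - s ≡ t - s + e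
    swap = solve-∀

  even-period : ∀ {p} → Prime p → p ℕ.∤ 4 → ∀ k c → 3 ℕ.^ (c ℕ.* 2) ≡1[mod p ℕ.^ k ] → IsPeriod (p ℕ.^ k) (c ℕ.* 2)
  even-period {p} p-prime p∤4 k c (T , 3ᴷ≡) n _ =
    ∣4u⇒≡[mod] p-prime p∤4 k n (n ℕ.+ c ℕ.* 2) (subst (_ ∣_) (sym difference) p^k∣-e)
    where
    e = 3 ℕ.^ n ℕ.* (T ℕ.* p ℕ.^ k)
    difference : 4u n - 4u (n ℕ.+ c ℕ.* 2) ≡ - + e
    difference = begin
      4u n - 4u (n ℕ.+ c ℕ.* 2)  ≡⟨ cong (λ i → 4u n - 4u i) (ℕ.+-comm n (c ℕ.* 2)) ⟩
      4u n - 4u (c ℕ.* 2 ℕ.+ n)  ≡⟨ cong (λ t → 4u n - t) (4u-even-shift c n 3ᴷ≡) ⟩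
      4u n - (4u n + + e)        ≡⟨ cancel (4u n) (+ e) ⟩
      - + e                      ∎
      where
      open ≡-Reasoning
      cancel : ∀ x y → x - (x + y) ≡ - y
      cancel = solve-∀
    p^k∣-e : + (p ℕ.^ k) ∣ - + e
    p^k∣-e = ∣m⇒∣-m (∣ᵤ⇒∣ (ℕ.∣n⇒∣m*n (3 ℕ.^ n) (ℕ.n∣m*n T)))

  4u-shift-second-order : ∀ c {Y} → 3 ℕ.^ (c ℕ.* 2) ≡ 1 ℕ.+ Y → ∀ k n →
    ∃ λ C → 4u (c ℕ.* 2 ℕ.* k ℕ.+ n) ≡ 4u n + + (3 ℕ.^ n) * + k * + Y + C * (+ Y * + Y)
  4u-shift-second-order c {Y} 3ᴷ≡ k n with [1+y]^n≡1+n*y+O[y²] Y k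
  ... | C , [1+Y]ᵏ≡ = + 3ⁿ * + C , (begin
    4u (c ℕ.* 2 ℕ.* k ℕ.+ n)                          ≡⟨ cong (λ i → 4u (i ℕ.+ n)) (rearrange c k) ⟩
    4u (c ℕ.* k ℕ.* 2 ℕ.+ n)                          ≡⟨ 4u-even-shift (c ℕ.* k) n 3ᴷᵏ≡ ⟩
    4u n + + (3ⁿ ℕ.* (k ℕ.* Y ℕ.+ C ℕ.* (Y ℕ.* Y)))   ≡⟨ cong (λ z → 4u n + z) cast ⟩
    4u n + (+ 3ⁿ * (+ k * + Y + + C * (+ Y * + Y)))   ≡⟨ expand (4u n) (+ 3ⁿ) (+ k) (+ Y) (+ C) ⟩
    4u n + + 3ⁿ * + k * + Y + + 3ⁿ * + C * (+ Y * + Y) ∎)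
    where
    open ≡-Reasoning
    3ⁿ = 3 ℕ.^ n
    rearrange : ∀ c k → c ℕ.* 2 ℕ.* k ≡ c ℕ.* k ℕ.* 2
    rearrange = ℕ-Solver.solve-∀
    3ᴷᵏ≡ : 3 ℕ.^ (c ℕ.* k ℕ.* 2) ≡ 1 ℕ.+ (k ℕ.* Y ℕ.+ C ℕ.* (Y ℕ.* Y))
    3ᴷᵏ≡ = begin
      3 ℕ.^ (c ℕ.* k ℕ.* 2)               ≡⟨ cong (3 ℕ.^_) (rearrange c k) ⟨
      3 ℕ.^ (c ℕ.* 2 ℕ.* k)               ≡⟨ ℕ.^-*-assoc 3 (c ℕ.* 2) k ⟨
      (3 ℕ.^ (c ℕ.* 2)) ℕ.^ k             ≡⟨ cong (ℕ._^ k) 3ᴷ≡ ⟩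
      (1 ℕ.+ Y) ℕ.^ k                     ≡⟨ [1+Y]ᵏ≡ ⟩
      1 ℕ.+ k ℕ.* Y ℕ.+ C ℕ.* (Y ℕ.* Y)   ≡⟨ ℕ.+-assoc 1 (k ℕ.* Y) (C ℕ.* (Y ℕ.* Y)) ⟩
      1 ℕ.+ (k ℕ.* Y ℕ.+ C ℕ.* (Y ℕ.* Y)) ∎
    cast : + (3ⁿ ℕ.* (k ℕ.* Y ℕ.+ C ℕ.* (Y ℕ.* Y))) ≡ + 3ⁿ * (+ k * + Y + + C * (+ Y * + Y))
    cast = begin
      + (3ⁿ ℕ.* (k ℕ.* Y ℕ.+ C ℕ.* (Y ℕ.* Y)))  ≡⟨ pos-* 3ⁿ _ ⟩
      + 3ⁿ * + (k ℕ.* Y ℕ.+ C ℕ.* (Y ℕ.* Y))     ≡⟨ cong (+ 3ⁿ *_) (pos-+ (k ℕ.* Y) _) ⟩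
      + 3ⁿ * (+ (k ℕ.* Y) + + (C ℕ.* (Y ℕ.* Y))) ≡⟨ cong (λ z → + 3ⁿ * z) (cong₂ _+_ (pos-* k Y)
                                                       (trans (pos-* C _) (cong (+ C *_) (pos-* Y Y)))) ⟩
      + 3ⁿ * (+ k * + Y + + C * (+ Y * + Y))     ∎
    expand : ∀ v t k y c → v + t * (k * y + c * (y * y)) ≡ v + t * k * y + t * c * (y * y)
    expand = solve-∀

  -- With Y = T q and q = p X, 3^(2ck) = (1 + Y)^k ≡ 1 + kY (mod Y²) and p q ∣ Y², so modulo p q the
  -- difference is (4u a − 4u b) + Y (3^a k − 3^b j) = q (s + T 3^a k − T 3^b j).
  4u-lift : ∀ c {T p X} → 3 ℕ.^ (c ℕ.* 2) ≡ 1 ℕ.+ T ℕ.* (p ℕ.* X) → ∀ {a b s} k j →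
            4u a - 4u b ≡ s * + (p ℕ.* X) →
            + p ∣ s + + (T ℕ.* 3 ℕ.^ a) * + k - + (T ℕ.* 3 ℕ.^ b) * + j →
            + (p ℕ.* (p ℕ.* X)) ∣ 4u (c ℕ.* 2 ℕ.* k ℕ.+ a) - 4u (c ℕ.* 2 ℕ.* j ℕ.+ b)
  4u-lift c {T} {p} {X} 3ᴷ≡ {a} {b} {s} k j 4ua-4ub≡ (divides w s+Ak-Bj≡) =
    let C₁ , shift₁ = 4u-shift-second-order c 3ᴷ≡ k a
        C₂ , shift₂ = 4u-shift-second-order c 3ᴷ≡ j b
        W = w + (C₁ - C₂) * t * t * + X
    in divides W (begin
      4u (c ℕ.* 2 ℕ.* k ℕ.+ a) - 4u (c ℕ.* 2 ℕ.* j ℕ.+ b)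
        ≡⟨ cong₂ _-_ shift₁ shift₂ ⟩
      (4u a + αa * + k * + Y + C₁ * (+ Y * + Y)) - (4u b + αb * + j * + Y + C₂ * (+ Y * + Y))
        ≡⟨ cong (λ y → (4u a + αa * + k * y + C₁ * (y * y)) - (4u b + αb * + j * y + C₂ * (y * y))) Y≡tQ ⟩
      (4u a + αa * + k * (t * Q) + C₁ * (t * Q * (t * Q))) - (4u b + αb * + j * (t * Q) + C₂ * (t * Q * (t * Q)))
        ≡⟨ regroup (4u a) (4u b) s t αa αb (+ k) (+ j) C₁ C₂ (+ p) (+ X) ⟩
      (4u a - 4u b - s * Q) + Q * (s + t * αa * + k - t * αb * + j) + (C₁ - C₂) * t * t * + X * (+ p * Q)
        ≡⟨ cong₂ (λ d e → d + Q * e + (C₁ - C₂) * t * t * + X * (+ p * Q)) 4ua-4ub-sQ≡0 s+Ak-Bj≡′ ⟩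
      0ℤ + Q * (w * + p) + (C₁ - C₂) * t * t * + X * (+ p * Q)
        ≡⟨ collect w (C₁ - C₂) t (+ X) (+ p) Q ⟩
      W * (+ p * Q)
        ≡⟨ cong (W *_) (trans (pos-* p (p ℕ.* X)) (cong (+ p *_) (pos-* p X))) ⟨
      W * + (p ℕ.* (p ℕ.* X)) ∎)
    where
    open ≡-Reasoning
    Y = T ℕ.* (p ℕ.* X)
    t = + T
    Q = + p * + X
    αa = + (3 ℕ.^ a)
    αb = + (3 ℕ.^ b)
    Y≡tQ : + Y ≡ t * Q
    Y≡tQ = trans (pos-* T _) (cong (t *_) (pos-* p X))
    4ua-4ub-sQ≡0 : 4u a - 4u b - s * Q ≡ 0ℤ
    4ua-4ub-sQ≡0 = trans (cong (_- s * Q) (trans 4ua-4ub≡ (cong (s *_) (pos-* p X)))) (+-inverseʳ (s * Q))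
    s+Ak-Bj≡′ : s + t * αa * + k - t * αb * + j ≡ w * + p
    s+Ak-Bj≡′ = trans (cong₂ (λ A B → s + A * + k - B * + j) (sym (pos-* T _)) (sym (pos-* T _))) s+Ak-Bj≡
    regroup : ∀ va vb s t αa αb k j C₁ C₂ p X →
      (va + αa * k * (t * (p * X)) + C₁ * (t * (p * X) * (t * (p * X))))
        - (vb + αb * j * (t * (p * X)) + C₂ * (t * (p * X) * (t * (p * X))))
      ≡ (va - vb - s * (p * X)) + (p * X) * (s + t * αa * k - t * αb * j) + (C₁ - C₂) * t * t * X * (p * (p * X))
    regroup = solve-∀
    collect : ∀ w D t X p Q → 0ℤ + Q * (w * p) + D * t * t * X * (p * Q) ≡ (w + D * t * t * X) * (p * Q)
    collect = solve-∀

module ResiduesModPrime where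

  open import Data.Nat as ℕ using (ℕ; suc)
  import Data.Nat.Properties as ℕ
  import Data.Nat.Divisibility as ℕ
  open import Data.Nat.Primality using (Prime; euclidsLemma)
  open import Data.Integer.Base using (ℤ; +_; _+_; _-_; _*_; -_; ∣_∣)
  open import Data.Integer.Properties using (+-injective; i-j≡0⇒i≡j; ∣i∣≡0⇒i≡0; abs-*; [+m]-[+n]≡m⊖n; ∣m⊝n∣≤m⊔n)
  open import Data.Integer.DivMod using (_/ℕ_; _%ℕ_; n%ℕd<d; a≡a%ℕn+[a/ℕn]*n)
  open import Data.Integer.Divisibility.Signed using (_∣_; divides; ∣⇒∣ᵤ; ∣m⇒∣-m)
  open import Data.Integer.Tactic.RingSolver using (solve-∀)
  open import Data.Fin.Base using (Fin; toℕ; fromℕ<; splitAt; _↑ˡ_; _↑ʳ_)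
  open import Data.Fin.Properties
    using (toℕ≤pred[n]; toℕ-fromℕ<; toℕ-injective; pigeonhole; splitAt⁻¹-↑ˡ; splitAt⁻¹-↑ʳ; <-irrefl)
  open import Data.Empty using (⊥-elim)
  open import Data.Product using (∃₂; _×_; _,_)
  open import Data.Sum using ([_,_]′; inj₁; inj₂)
  open import Function using (_∘_)
  open import Relation.Binary.PropositionalEquality
  open PrimeArithmetic using (∣∧<⇒≡0)

  ∣x-y⇒∣y-x : ∀ {d} x y → d ∣ x - y → d ∣ y - x
  ∣x-y⇒∣y-x {d} x y = subst (d ∣_) (flip x y) ∘ ∣m⇒∣-m
    where
    flip : ∀ x y → - (x - y) ≡ y - x
    flip = solve-∀

  module _ (p : ℕ) .{{_ : ℕ.NonZero p}} where

    residue : ℤ → Fin p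
    residue x = fromℕ< (n%ℕd<d x p)

    residue-≡⇒∣ : ∀ x y → residue x ≡ residue y → + p ∣ x - y
    residue-≡⇒∣ x y same = divides (qx - qy) (begin
      x - y                                   ≡⟨ cong₂ _-_ (a≡a%ℕn+[a/ℕn]*n x p) (a≡a%ℕn+[a/ℕn]*n y p) ⟩
      (+ rx + qx * + p) - (+ ry + qy * + p)   ≡⟨ cong (λ r → (+ r + qx * + p) - (+ ry + qy * + p)) rx≡ry ⟩
      (+ ry + qx * + p) - (+ ry + qy * + p)   ≡⟨ cancel (+ ry) qx qy (+ p) ⟩
      (qx - qy) * + p                         ∎)
      where
      open ≡-Reasoning
      rx = x %ℕ p
      ry = y %ℕ p
      qx = x /ℕ p
      qy = y /ℕ p
      rx≡ry : rx ≡ ry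
      rx≡ry = trans (sym (toℕ-fromℕ< _)) (trans (cong toℕ same) (toℕ-fromℕ< _))
      cancel : ∀ r a b d → (r + a * d) - (r + b * d) ≡ (a - b) * d
      cancel = solve-∀

  InjectiveMod : (p h : ℕ) → (ℕ → ℤ) → Set
  InjectiveMod p h f = ∀ {k l} → k ℕ.≤ h → l ℕ.≤ h → + p ∣ f k - f l → k ≡ l

  residues-meet : ∀ {p h} .{{_ : ℕ.NonZero p}} (f g : ℕ → ℤ) → p ℕ.< suc h ℕ.+ suc h →
                  InjectiveMod p h f → InjectiveMod p h g → ∃₂ λ k j → k ℕ.≤ h × j ℕ.≤ h × + p ∣ f k - g j
  residues-meet {p} {h} f g p<2+2h f-inj g-inj
    with i , i′ , i<i′ , same ← pigeonhole p<2+2h (residue p ∘ [ f ∘ toℕ , g ∘ toℕ ]′ ∘ splitAt (suc h))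
    with splitAt (suc h) i in eq | splitAt (suc h) i′ in eq′
  ... | inj₁ k | inj₁ k′ = ⊥-elim (<-irrefl i≡i′ i<i′)
    where
    k≡k′ : k ≡ k′
    k≡k′ = toℕ-injective (f-inj (toℕ≤pred[n] k) (toℕ≤pred[n] k′) (residue-≡⇒∣ p (f (toℕ k)) (f (toℕ k′)) same))
    i≡i′ : i ≡ i′
    i≡i′ = trans (sym (splitAt⁻¹-↑ˡ eq)) (trans (cong (_↑ˡ _) k≡k′) (splitAt⁻¹-↑ˡ eq′))
  ... | inj₂ j | inj₂ j′ = ⊥-elim (<-irrefl i≡i′ i<i′)
    where
    j≡j′ : j ≡ j′
    j≡j′ = toℕ-injective (g-inj (toℕ≤pred[n] j) (toℕ≤pred[n] j′) (residue-≡⇒∣ p (g (toℕ j)) (g (toℕ j′)) same))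
    i≡i′ : i ≡ i′
    i≡i′ = trans (sym (splitAt⁻¹-↑ʳ eq)) (trans (cong (suc h ↑ʳ_) j≡j′) (splitAt⁻¹-↑ʳ eq′))
  ... | inj₁ k | inj₂ j =
    toℕ k , toℕ j , toℕ≤pred[n] k , toℕ≤pred[n] j , residue-≡⇒∣ p (f (toℕ k)) (g (toℕ j)) same
  ... | inj₂ j | inj₁ k =
    toℕ k , toℕ j , toℕ≤pred[n] k , toℕ≤pred[n] j ,
    ∣x-y⇒∣y-x (g (toℕ j)) (f (toℕ k)) (residue-≡⇒∣ p (g (toℕ j)) (f (toℕ k)) same)

  shift-injective : ∀ {p h f} s → InjectiveMod p h f → InjectiveMod p h (λ k → s + f k)
  shift-injective {p} {f = f} s f-inj {k} {l} k≤h l≤h p∣ = f-inj k≤h l≤h (subst (+ p ∣_) (cancel s (f k) (f l)) p∣)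
    where
    cancel : ∀ s x y → s + x - (s + y) ≡ x - y
    cancel = solve-∀

  linear-injective : ∀ {p h} → Prime p → h ℕ.< p → ∀ {A} → p ℕ.∤ ∣ A ∣ → InjectiveMod p h (λ k → A * + k)
  linear-injective {p} {h} p-prime h<p {A} p∤A {k} {l} k≤h l≤h p∣Ak-Al =
    +-injective (i-j≡0⇒i≡j (+ k) (+ l) (∣i∣≡0⇒i≡0 (∣∧<⇒≡0 p∣k-l k-l<p)))
    where
    p∣A*[k-l] : p ℕ.∣ ∣ A ∣ ℕ.* ∣ + k - + l ∣
    p∣A*[k-l] = subst (p ℕ.∣_) (abs-* A (+ k - + l)) (∣⇒∣ᵤ (subst (+ p ∣_) (factor A (+ k) (+ l)) p∣Ak-Al))
      where
      factor : ∀ a x y → a * x - a * y ≡ a * (x - y)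
      factor = solve-∀
    p∣k-l : p ℕ.∣ ∣ + k - + l ∣
    p∣k-l = [ (λ p∣A → ⊥-elim (p∤A p∣A)) , (λ p∣k-l → p∣k-l) ]′ (euclidsLemma _ _ p-prime p∣A*[k-l])
    k-l<p : ∣ + k - + l ∣ ℕ.< p
    k-l<p = ℕ.≤-<-trans (subst (ℕ._≤ k ℕ.⊔ l) (cong ∣_∣ (sym ([+m]-[+n]≡m⊖n k l))) (∣m⊝n∣≤m⊔n k l))
                        (ℕ.≤-<-trans (ℕ.⊔-lub k≤h l≤h) h<p)

module IncongruenceIndex where

  open import Data.Nat
  open import Data.Nat.Properties
  open import Data.Nat.Divisibility using (_∣_; _∣?_)
  open import Data.Integer.Properties using (∣i-j∣≡∣j-i∣)
  open import Data.Product using (∃; _×_; _,_)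
  open import Data.Sum using (inj₁; inj₂)
  open import Relation.Nullary using (¬_; yes; no; contradiction)
  open import Relation.Nullary.Decidable using (_×-dec_)
  open import Relation.Binary.Definitions using (tri<; tri≈; tri>)
  open import Relation.Binary.PropositionalEquality

  private variable N i x y : ℕ

  ≡[mod]-sym : ∀ a b → a ≡ b [mod N ] → b ≡ a [mod N ]
  ≡[mod]-sym {N} a b = subst (N ∣_) (∣i-j∣≡∣j-i∣ a b)

  iota-maximal : IsIota N i → ¬ PairwiseIncong N (suc i)
  iota-maximal (_ , maximal) pw = n≮n _ (maximal _ pw)

  collision-with-next : PairwiseIncong N i → ¬ PairwiseIncong N (suc i) →
                        ∃ λ a → 1 ≤ a × a < suc i × u a ≡ u (suc i) [mod N ]
  collision-with-next {N} {i} pw ¬pw′ with anyUpTo? (λ a → (1 ≤? a) ×-dec (N ∣? _)) (suc i)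
  ... | yes (a , a<1+i , 1≤a , ua≡u[1+i]) = a , 1≤a , a<1+i , ua≡u[1+i]
  ... | no none = contradiction pw′ ¬pw′
    where
    pw′ : PairwiseIncong N (suc i)
    pw′ a b 1≤a a<b b≤1+i with m≤n⇒m<n∨m≡n b≤1+i
    ... | inj₁ b<1+i = pw a b 1≤a a<b (s≤s⁻¹ b<1+i)
    ... | inj₂ refl  = λ ua≡ub → none (a , a<b , 1≤a , ua≡ub)

  collision⇒iota< : IsIota N i → 1 ≤ x → x < y → u x ≡ u y [mod N ] → i < y
  collision⇒iota< (pw , _) 1≤x x<y ux≡uy = ≰⇒> λ y≤i → pw _ _ 1≤x x<y y≤i ux≡uy

  collision⇒iota<bound : ∀ {L} → IsIota N i → 1 ≤ x → 1 ≤ y → x ≢ y → x ≤ L → y ≤ L →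
                         u x ≡ u y [mod N ] → i < L
  collision⇒iota<bound {x = x} {y} ι 1≤x 1≤y x≢y x≤L y≤L ux≡uy with <-cmp x y
  ... | tri< x<y _ _ = <-≤-trans (collision⇒iota< ι 1≤x x<y ux≡uy) y≤L
  ... | tri≈ _ x≡y _ = contradiction x≡y x≢y
  ... | tri> _ _ y<x = <-≤-trans (collision⇒iota< ι 1≤y y<x (≡[mod]-sym (u x) (u y) ux≡uy)) x≤L

  n*k+a≢n*j+b : ∀ {n a b} k j → 1 ≤ a → a < b → b ≤ n → n * k + a ≢ n * j + b
  n*k+a≢n*j+b {n} {a} {b} k j 1≤a a<b b≤n with ≤-<-connex k j
  ... | inj₁ k≤j = <⇒≢ (+-mono-≤-< (*-monoʳ-≤ n k≤j) a<b)
  ... | inj₂ j<k = ≢-sym (<⇒≢ (begin-strict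
    n * j + b      ≤⟨ +-monoʳ-≤ (n * j) b≤n ⟩
    n * j + n      ≡⟨ +-comm (n * j) n ⟩
    n + n * j      ≡⟨ *-suc n j ⟨
    n * suc j      ≤⟨ *-monoʳ-≤ n j<k ⟩
    n * k          <⟨ m<m+n (n * k) 1≤a ⟩
    n * k + a      ∎))
    where open ≤-Reasoning

  n*k+a≤n*[1+l] : ∀ {n k a l} → k ≤ l → a ≤ n → n * k + a ≤ n * suc l
  n*k+a≤n*[1+l] {n} {k} {a} {l} k≤l a≤n = begin
    n * k + a   ≤⟨ +-mono-≤ (*-monoʳ-≤ n k≤l) a≤n ⟩
    n * l + n   ≡⟨ +-comm (n * l) n ⟩
    n + n * l   ≡⟨ *-suc n l ⟨
    n * suc l   ∎
    where open ≤-Reasoning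

open import Data.Nat
open import Data.Nat.Properties
open import Data.Nat.Divisibility using (_∣_; _∤_; _∣?_; divides; >⇒∤)
open import Data.Nat.Primality using (Prime; prime⇒nonZero)
open import Data.Nat.Tactic.RingSolver using (solve-∀)
open import Data.Integer.Base as ℤ using (+_)
open import Data.Integer.Divisibility.Signed using (divides)
open import Data.Product using (∃₂; _×_; _,_; proj₁)
open import Relation.Nullary using (yes; no)
open import Relation.Binary.PropositionalEquality
open PrimeArithmetic
open Numerator
open ResiduesModPrime
open IncongruenceIndex

-- P = p^m (p - 1) = φ(q) for q = p^(m+1), and T = (3^P - 1)/q.
module Lifting {p h m T : ℕ} (p-prime : Prime p) (3<p : 3 < p) (p≡1+2h : p ≡ suc (h * 2))
               (3ᴾ≡ : 3 ^ (p ^ m * h * 2) ≡ 1 + T * p ^ suc m) where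

  X = p ^ m
  q = p ^ suc m
  H = X * h
  P = H * 2

  private instance
    p≢0 = prime⇒nonZero p-prime

  p∤4 : p ∤ 4
  p∤4 = prime∤-* p-prime p∤2 p∤2
    where
    p∤2 : p ∤ 2
    p∤2 = >⇒∤ (<-trans (n<1+n 2) 3<p)

  p∤T*3^ : p ∤ T → ∀ n → p ∤ T * 3 ^ n
  p∤T*3^ p∤T n = prime∤-* p-prime p∤T (prime∤-^ p-prime (>⇒∤ 3<p) n)

  1≤h : 1 ≤ h
  1≤h = *-cancelʳ-≤ 1 h 2 (≤-trans (n≤1+n 2) (s≤s⁻¹ (subst (3 <_) p≡1+2h 3<p)))

  h<p : h < p
  h<p = subst (h <_) (sym p≡1+2h) (s≤s (m≤m*n h 2))

  p<2+2h : p < suc h + suc h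
  p<2+2h = subst (_< suc h + suc h) (sym p≡1+2h) (≤-reflexive (double h))
    where
    double : ∀ h → suc (suc (h * 2)) ≡ suc h + suc h
    double = solve-∀

  1≤P : 1 ≤ P
  1≤P = *-mono-≤ (*-mono-≤ (m^n>0 p m) 1≤h) (s≤s z≤n)

  1+P≤P*[1+h] : suc P ≤ P * suc h
  1+P≤P*[1+h] = ≤-trans (+-monoˡ-≤ P (*-mono-≤ 1≤P 1≤h)) (n*k+a≤n*[1+l] {P} ≤-refl ≤-refl)

  P-period : IsPeriod q P
  P-period = even-period p-prime p∤4 (suc m) H (T , 3ᴾ≡)

  P-period-lifted : p ∣ T → IsPeriod (p * q) P
  P-period-lifted (divides T′ refl) =
    even-period p-prime p∤4 (suc (suc m)) H (T′ , trans 3ᴾ≡ (cong suc (*-assoc T′ p q)))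

  lifted-collision : p ∤ T → ∀ {a b} → u a ≡ u b [mod q ] →
                     ∃₂ λ k j → k ≤ h × j ≤ h × u (P * k + a) ≡ u (P * j + b) [mod p * q ]
  lifted-collision p∤T {a} {b} ua≡ub =
    let divides s 4ua-4ub≡ = ≡[mod]⇒∣4u {a = a} {b} ua≡ub
        k , j , k≤h , j≤h , meet = residues-meet
          (λ k → s ℤ.+ + (T * 3 ^ a) ℤ.* + k) (λ j → + (T * 3 ^ b) ℤ.* + j) p<2+2h
          (shift-injective s (linear-injective p-prime h<p {+ (T * 3 ^ a)} (p∤T*3^ p∤T a)))
          (linear-injective p-prime h<p {+ (T * 3 ^ b)} (p∤T*3^ p∤T b))
    in k , j , k≤h , j≤h , ∣4u⇒≡[mod] p-prime p∤4 (suc (suc m)) (P * k + a) (P * j + b)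
                             (4u-lift H {T} {p} {X} 3ᴾ≡ {a} {b} {s} k j 4ua-4ub≡ meet)

  iota[pq]<P*[1+h] : ∀ {i r i′} → IsIota q i → IsRho q r → i < r → IsIota (p * q) i′ → i′ < P * suc h
  iota[pq]<P*[1+h] {i} ι (_ , _ , minimal) i<r ι′ with p ∣? T
  ... | yes p∣T = <-≤-trans (collision⇒iota< ι′ ≤-refl (s≤s 1≤P) (P-period-lifted p∣T 1 ≤-refl)) 1+P≤P*[1+h]
  ... | no p∤T =
    let a , 1≤a , a<b , ua≡ub = collision-with-next (proj₁ ι) (iota-maximal ι)
        k , j , k≤h , j≤h , lifted = lifted-collision p∤T {a} {suc i} ua≡ub
    in collision⇒iota<bound ι′ (≤-trans 1≤a (m≤n+m a (P * k))) (≤-trans (s≤s z≤n) (m≤n+m (suc i) (P * j)))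
         (n*k+a≢n*j+b k j 1≤a a<b b≤P) (n*k+a≤n*[1+l] k≤h (≤-trans (<⇒≤ a<b) b≤P)) (n*k+a≤n*[1+l] j≤h b≤P) lifted
    where
    b≤P : suc i ≤ P
    b≤P = ≤-trans i<r (minimal P 1≤P P-period)

  2*P*[1+h]<p*q : 2 * (P * suc h) < p * q
  2*P*[1+h]<p*q = begin-strict
    2 * (P * suc h)                  <⟨ m<m+n _ (m^n>0 p m) ⟩
    2 * (P * suc h) + X              ≡⟨ square X h ⟩
    suc (h * 2) * (suc (h * 2) * X)  ≡⟨ cong (λ p → p * (p * X)) p≡1+2h ⟨
    p * q                            ∎
    where
    open ≤-Reasoning
    square : ∀ X h → 2 * (X * h * 2 * suc h) + X ≡ suc (h * 2) * (suc (h * 2) * X)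
    square = solve-∀

lemma16 : (p m : ℕ) → Prime p → 3 < p → 1 ≤ m →
          (i r : ℕ) → IsIota (p ^ m) i → IsRho (p ^ m) r → i < r →
          (i′ : ℕ) → IsIota (p ^ (m + 1)) i′ → 2 * i′ < p ^ (m + 1)
lemma16 p (suc m) p-prime 3<p _ i r ι ρ i<r i′ ι′
  with h , p≡1+2h ← odd-prime p-prime (<-trans (n<1+n 2) 3<p)
  with T , 3ᴾ≡ ← euler p-prime (>⇒∤ 3<p) m
  = subst (2 * i′ <_) (sym p^[m+2]≡p*q)
      (<-trans (*-monoʳ-< 2 (iota[pq]<P*[1+h] ι ρ i<r (subst (λ N → IsIota N i′) p^[m+2]≡p*q ι′)))
               2*P*[1+h]<p*q)
  where
  p^[m+2]≡p*q : p ^ (suc m + 1) ≡ p * p ^ suc m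
  p^[m+2]≡p*q = cong (p ^_) (+-comm (suc m) 1)
  exponent≡ : p ^ m * (p ∸ 1) ≡ p ^ m * h * 2
  exponent≡ = trans (cong (λ n → p ^ m * (n ∸ 1)) p≡1+2h) (sym (*-assoc (p ^ m) h 2))
  open Lifting {p} {h} {m} {T} p-prime 3<p p≡1+2h (subst (λ e → 3 ^ e ≡ 1 + T * p ^ suc m) exponent≡ 3ᴾ≡)
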